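{- Let $\alpha/\!/\beta$ be a skew composition of size $n$ and let $T_1,T_2$ be standard composition tableaux of shape $\alpha/\!/\beta$ such that $T_2=\pi_iT_1$ for some $i\in nAD(T_1)$. Then the outer shape of $T_2^{>i}$ is strictly smaller than the outer shape of $T_1^{>i}$ in the preorder $\trianglelefteq$ (i.e. $\mathrm{osh}(T_2^{>i})\trianglelefteq\mathrm{osh}(T_1^{>i})$ and $\mathrm{osh}(T_2^{>i})\ne\mathrm{osh}(T_1^{>i})$), and $\mathrm{osh}(T_2^{>m})=\mathrm{osh}(T_1^{>m})$ for all $m\in[0,n]$ with $m\ne i$.
   Context: Compositions $\alpha=(\alpha_1,\dots,\alpha_l)$ have diagrams $\{(i,j):i\le l,j\le\alpha_i\}$ (matrix coordinates, row 1 on top). Composition poset $\mathcal L_c$: $\beta\lessdot_c\alpha$ iff $\alpha=(1,\beta_1,\dots,\beta_l)$ or $\alpha$ is obtained from $\beta$ by increasing $\beta_k$ by one where $\beta_i\ne\beta_k$ for all $i<k$; $\le_c$ its reflexive-transitive closure. For $\beta\le_c\alpha$ the diagrams of $\beta$ and of intermediate compositions are placed at the bottom of $\alpha$'s diagram; the skew shape $\alpha/\!/\beta$ is the set of cells of $\alpha$ not in $\beta$, of size $|\alpha|-|\beta|$. An SCT of shape $\alpha/\!/\beta$ and size $n$ is a bijection $T:\alpha/\!/\beta\to[n]$ with rows decreasing left to right, first column increasing top to bottom, and the triple rule: with $T=\infty$ on cells of $\beta$, if $(j,k)\in\alpha/\!/\beta$, $(i,k-1)\in\alpha$, $j>i$,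 $T(j,k)<T(i,k-1)$, then $(i,k)\in\alpha$ and $T(j,k)<T(i,k)$. SCTs of shape $\alpha/\!/\beta$ correspond bijectively to saturated chains $\beta=\alpha^n\lessdot_c\cdots\lessdot_c\alpha^0=\alpha$ via $\alpha^n=\beta$, $\alpha^{k-1}=\alpha^k\cup T^{ -1}(k)$. $T^{>m}$ is the SCT of shape $\alpha^m/\!/\beta$ corresponding to $\alpha^n\lessdot_c\cdots\lessdot_c\alpha^m$; its outer shape $\mathrm{osh}(T^{>m})$ is $\alpha^m$. Let $c_T(k)$ be the column of $T^{ -1}(k)$; a cell $(i,j)$ attacks $(i',j')$ if $j=j'$ and $i\ne i'$, or $j=j'-1$ and $i<i'$. $D(T)=\{i\in[n-1]:c_T(i)\le c_T(i+1)\}$, $AD(T)=\{i\in D(T):T^{ -1}(i)\text{ attacks }T^{ -1}(i+1)\}$, $nAD(T)=D(T)\setminus AD(T)$. The 0-Hecke generator $\pi_i$ acts by $\pi_iT=T$ if $i\notin D(T)$, $0$ if $i\in AD(T)$, and by interchanging the entries $i$ and $i+1$ if $i\in nAD(T)$. For a composition $\gamma$ and $j\in\mathbb N$, $|\gamma|_j=\#\{i:\gamma_i\ge j\}$. For compositions $\gamma,\eta$ of the same size, $\gamma\trianglelefteq\eta$ iff $\sum_{j=1}^k|\eta|_j\le\sum_{j=1}^k|\gamma|_j$ for all $k\ge1$ (a preorder). -}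

module Defs where

open import Data.Nat using (ℕ; zero; suc; _+_; _∸_; _≤_; _<_; _≤ᵇ_; _<ᵇ_)
open import Data.Bool using (Bool; true; false; _∨_; _∧_; if_then_else_)
open import Data.List using (List; []; _∷_; _++_; length; filter; map)
open import Data.Nat.ListAction using (sum)
open import Data.List.Relation.Unary.All using (All)
open import Data.Product using (_×_; Σ; ∃; _,_)
open import Data.Sum using (_⊎_)
open import Relation.Nullary using (¬_)
open import Relation.Binary.PropositionalEquality using (_≡_; _≢_)
open import Relation.Binary.Construct.Closure.ReflexiveTransitive using (Star)
import Data.Nat as ℕ
open import Relation.Nullary.Decidable using (¬?)
open import Relation.Nullary.Decidable.Core using (T?)

Composition : Set
Composition = List ℕ

IsComposition : List ℕ → Set
IsComposition = All (λ x → 0 < x)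

-- 1-indexed row length: rowLen α i = α_i, and 0 if i = 0 or i > ℓ(α).
rowLen : List ℕ → ℕ → ℕ
rowLen []       _             = 0
rowLen (x ∷ xs) zero          = 0
rowLen (x ∷ xs) (suc zero)    = x
rowLen (x ∷ xs) (suc (suc i)) = rowLen xs (suc i)

data _⋖c_ : Composition → Composition → Set where
  prepend : ∀ β → β ⋖c (1 ∷ β)
  incr    : ∀ (pre : List ℕ) (b : ℕ) (post : List ℕ) →
            All (λ x → x ≢ b) pre →
            (pre ++ b ∷ post) ⋖c (pre ++ suc b ∷ post)

_≤c_ : Composition → Composition → Set
_≤c_ = Star _⋖c_

-- Cells (matrix coordinates, rows and columns 1-indexed, row 1 on top)

InDiag : Composition → ℕ → ℕ → Set
InDiag α i j = 1 ≤ i × 1 ≤ j × j ≤ rowLen α i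

-- (i , j) is a cell of β, where β's diagram is placed at the bottom of α's:
-- row r of β sits in row r + (ℓ(α) ∸ ℓ(β)) of α.
InInner : Composition → Composition → ℕ → ℕ → Set
InInner α β i j = (length α ∸ length β) < i × 1 ≤ j × j ≤ rowLen β (i ∸ (length α ∸ length β))

InSkew : Composition → Composition → ℕ → ℕ → Set
InSkew α β i j = InDiag α i j × ¬ InInner α β i j

-- Standard composition tableaux of skew shape α//β and size n.
-- A filling is a function ℕ → ℕ → ℕ (row, column ↦ entry); only its values
-- on the cells of α//β are relevant.

Filling : Set
Filling = ℕ → ℕ → ℕ

-- x < T̂(i,k), where T̂ = T on α//β and T̂ = ∞ on the cells of β
-- (false if (i,k) ∉ α)
LtHat : Composition → Composition → Filling → ℕ → ℕ → ℕ → Set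
LtHat α β T x i k = InInner α β i k ⊎ (InSkew α β i k × x < T i k)

record IsSCT (α β : Composition) (n : ℕ) (T : Filling) : Set where
  field
    range     : ∀ i j → InSkew α β i j → 1 ≤ T i j × T i j ≤ n
    injective : ∀ i j i' j' → InSkew α β i j → InSkew α β i' j' →
                T i j ≡ T i' j' → i ≡ i' × j ≡ j'
    surjective : ∀ k → 1 ≤ k → k ≤ n → ∃ λ i → ∃ λ j → InSkew α β i j × T i j ≡ k
    rowDecr   : ∀ i j → InSkew α β i j → InSkew α β i (suc j) → T i (suc j) < T i j
    colIncr   : ∀ i i' → InSkew α β i 1 → InSkew α β i' 1 → i < i' → T i 1 < T i' 1
    triple    : ∀ i j k → InSkew α β j (suc k) → InDiag α i k → i < j →
                LtHat α β T (T j (suc k)) i k →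
                InDiag α i (suc k) × LtHat α β T (T j (suc k)) i (suc k)

record SCT (α β : Composition) (n : ℕ) (T : Filling) : Set where
  field
    outerComp : IsComposition α
    innerComp : IsComposition β
    skew      : β ≤c α
    isSCT     : IsSCT α β n T

-- Outer shape of T^{>m}: α^m = β ∪ T⁻¹({m+1,…,n}) placed at the bottom of α.

upFrom1 : ℕ → List ℕ
upFrom1 zero    = []
upFrom1 (suc k) = upFrom1 k ++ (suc k ∷ [])

-- is (i , j) a cell of α^m (given that (i,j) ∈ α) ?
inOsh : Composition → Composition → Filling → ℕ → ℕ → ℕ → Bool
inOsh α β T m i j =
  (((length α ∸ length β) <ᵇ i) ∧ (j ≤ᵇ rowLen β (i ∸ (length α ∸ length β))))
  ∨ (m <ᵇ T i j)

-- length of row i of α^m (in α's row coordinates)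
oshRow : Composition → Composition → Filling → ℕ → ℕ → ℕ
oshRow α β T m i = length (filter (λ j → T? (inOsh α β T m i j)) (upFrom1 (rowLen α i)))

osh : Composition → Composition → Filling → ℕ → Composition
osh α β T m = filter (λ r → ¬? (r ℕ.≟ 0)) (map (oshRow α β T m) (upFrom1 (length α)))

Attacks : ℕ × ℕ → ℕ × ℕ → Set
Attacks (r , c) (r' , c') = (c ≡ c' × r ≢ r') ⊎ (suc c ≡ c' × r < r')

InNAD : Composition → Composition → ℕ → Filling → ℕ → Set
InNAD α β n T i =
  1 ≤ i × i < n ×
  ∃ λ r → ∃ λ c → ∃ λ r' → ∃ λ c' →
    InSkew α β r c × InSkew α β r' c' ×
    T r c ≡ i × T r' c' ≡ suc i ×
    c ≤ c' × ¬ Attacks (r , c) (r' , c')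

swapVal : ℕ → ℕ → ℕ
swapVal i x = if x ℕ.≡ᵇ i then suc i else (if x ℕ.≡ᵇ suc i then i else x)

πnAD : ℕ → Filling → Filling
πnAD i T r c = swapVal i (T r c)

colHeight : Composition → ℕ → ℕ
colHeight γ j = length (filter (λ x → j ℕ.≤? x) γ)

partialCol : Composition → ℕ → ℕ
partialCol γ zero    = 0
partialCol γ (suc k) = partialCol γ k + colHeight γ (suc k)

_⊴_ : Composition → Composition → Set
γ ⊴ η = sum γ ≡ sum η × (∀ k → 1 ≤ k → partialCol η k ≤ partialCol γ k)

-- Interchanging the entries i and i+1 changes whether an entry exceeds m only when m = i,
-- so osh(T^{>m}) is unchanged for m ≠ i.  For m = i, α^i gains the cell (r, c) holding i and
-- loses the cell (r', c') holding i+1, where c < c' because i is a non-attacking descent.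
-- Rows decrease, so in osh(T₁^{>i}) row r has length a < c and row r' has length b + 1 ≥ c';
-- in particular r ≠ r' and a < b.  Hence osh(T₂^{>i}) is obtained by moving one cell from a
-- row of length b + 1 to a row of length a < b.  Since Σ_{j ≤ k} |γ|_j = Σ_ρ min(γ_ρ, k), this
-- preserves the size and cannot decrease any partial column sum, and it raises the one at k = a + 1.
module Submission where

open import Defs
open import Data.Nat using (ℕ; zero; suc; _+_; _∸_; _≤_; _<_; _≤′_; ≤′-refl; ≤′-step; _⊓_; _≡ᵇ_; _≤ᵇ_; _<ᵇ_; _≟_; _≤?_; _<?_; z≤n; s≤s)
open import Data.Nat.Properties
open import Algebra.Properties.CommutativeSemigroup +-commutativeSemigroup using (interchange; x∙yz≈xz∙y; xy∙z≈xz∙y)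
open import Data.Bool using (Bool; true; false; if_then_else_)
open import Data.List using (List; []; _∷_; [_]; _++_; length; filter; map)
open import Data.List.Properties using (map-++; map-∘; map-cong; map-id)
open import Data.Nat.ListAction using (sum)
open import Data.Nat.ListAction.Properties using (sum-++)
open import Data.Product using (_×_; _,_; proj₁; proj₂)
open import Data.Sum using (inj₁)
open import Function using (_∘_; id)
open import Relation.Nullary using (¬_; Dec; yes; no; contradiction)
open import Relation.Nullary.Decidable using (¬?; _×-dec_)
open import Relation.Nullary.Decidable.Core using (T?)
open import Relation.Nullary.Reflects using (ofʸ; ofⁿ)
open import Relation.Binary.PropositionalEquality using (_≡_; _≢_; refl; sym; trans; cong; cong₂; subst; subst₂; module ≡-Reasoning)

<ᵇ-true : ∀ {m n} → m < n → (m <ᵇ n) ≡ true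
<ᵇ-true {m} {n} m<n with m <ᵇ n | <ᵇ-reflects-< m n
... | true  | _        = refl
... | false | ofⁿ m≮n = contradiction m<n m≮n

<ᵇ-false : ∀ {m n} → n ≤ m → (m <ᵇ n) ≡ false
<ᵇ-false {m} {n} n≤m with m <ᵇ n | <ᵇ-reflects-< m n
... | true  | ofʸ m<n = contradiction n≤m (<⇒≱ m<n)
... | false | _       = refl

<ᵇ-suc : ∀ {m n} → m ≢ n → (m <ᵇ suc n) ≡ (m <ᵇ n)
<ᵇ-suc {zero}  {zero}  0≢0 = contradiction refl 0≢0
<ᵇ-suc {zero}  {suc n} _   = refl
<ᵇ-suc {suc m} {zero}  _   = refl
<ᵇ-suc {suc m} {suc n} m≢n = <ᵇ-suc (m≢n ∘ cong suc)

≡ᵇ-refl : ∀ n → (n ≡ᵇ n) ≡ true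
≡ᵇ-refl zero    = refl
≡ᵇ-refl (suc n) = ≡ᵇ-refl n

≡ᵇ-false : ∀ {m n} → m ≢ n → (m ≡ᵇ n) ≡ false
≡ᵇ-false {m} {n} m≢n with m ≡ᵇ n | ≡ᵇ⇒≡ m n
... | true  | m≡n = contradiction (m≡n _) m≢n
... | false | _   = refl

sumUpTo : (ℕ → ℕ) → ℕ → ℕ
sumUpTo F zero    = 0
sumUpTo F (suc N) = sumUpTo F N + F (suc N)

sum-map-upFrom1 : ∀ F N → sum (map F (upFrom1 N)) ≡ sumUpTo F N
sum-map-upFrom1 F zero    = refl
sum-map-upFrom1 F (suc N) = begin
  sum (map F (upFrom1 N ++ [ suc N ]))        ≡⟨ cong sum (map-++ F (upFrom1 N) [ suc N ]) ⟩
  sum (map F (upFrom1 N) ++ [ F (suc N) ])    ≡⟨ sum-++ (map F (upFrom1 N)) [ F (suc N) ] ⟩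
  sum (map F (upFrom1 N)) + (F (suc N) + 0)   ≡⟨ cong₂ _+_ (sum-map-upFrom1 F N) (+-identityʳ (F (suc N))) ⟩
  sumUpTo F (suc N)                           ∎
  where open ≡-Reasoning

sumUpTo-cong : ∀ {F G} N → (∀ ρ → 1 ≤ ρ → ρ ≤ N → F ρ ≡ G ρ) → sumUpTo F N ≡ sumUpTo G N
sumUpTo-cong zero    F≗G = refl
sumUpTo-cong (suc N) F≗G =
  cong₂ _+_ (sumUpTo-cong N (λ ρ 1≤ρ ρ≤N → F≗G ρ 1≤ρ (m≤n⇒m≤1+n ρ≤N))) (F≗G (suc N) (s≤s z≤n) ≤-refl)

-- Both sides are moved so that no subtraction occurs.
sumUpTo-update : ∀ {F G r} N → (∀ ρ → 1 ≤ ρ → ρ ≤ N → ρ ≢ r → F ρ ≡ G ρ) → 1 ≤ r → r ≤ N →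
                 sumUpTo G N + F r ≡ sumUpTo F N + G r
sumUpTo-update zero F≗G 1≤r r≤0 = contradiction (≤-trans 1≤r r≤0) λ ()
sumUpTo-update {F} {G} {r} (suc N) F≗G 1≤r r≤1+N with suc N ≟ r
... | yes refl = begin
  (sumUpTo G N + G r) + F r  ≡⟨ cong (λ s → (s + G r) + F r) (sumUpTo-cong N (λ ρ 1≤ρ ρ≤N → sym (F≗G ρ 1≤ρ (m≤n⇒m≤1+n ρ≤N) (<⇒≢ (s≤s ρ≤N))))) ⟩
  (sumUpTo F N + G r) + F r  ≡⟨ xy∙z≈xz∙y (sumUpTo F N) (G r) (F r) ⟩
  (sumUpTo F N + F r) + G r  ∎
  where open ≡-Reasoning
... | no 1+N≢r = begin
  (sumUpTo G N + G (suc N)) + F r  ≡⟨ xy∙z≈xz∙y (sumUpTo G N) (G (suc N)) (F r) ⟩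
  (sumUpTo G N + F r) + G (suc N)  ≡⟨ cong₂ _+_ (sumUpTo-update N (λ ρ 1≤ρ ρ≤N → F≗G ρ 1≤ρ (m≤n⇒m≤1+n ρ≤N)) 1≤r r≤N)
                                               (sym (F≗G (suc N) (s≤s z≤n) ≤-refl 1+N≢r)) ⟩
  (sumUpTo F N + G r) + F (suc N)  ≡⟨ xy∙z≈xz∙y (sumUpTo F N) (G r) (F (suc N)) ⟩
  (sumUpTo F N + F (suc N)) + G r  ∎
  where
  open ≡-Reasoning
  r≤N : r ≤ N
  r≤N = m<1+n⇒m≤n (≤∧≢⇒< r≤1+N (1+N≢r ∘ sym))

sumUpTo-update₂ : ∀ {F G r r'} N → (∀ ρ → 1 ≤ ρ → ρ ≤ N → ρ ≢ r → ρ ≢ r' → F ρ ≡ G ρ) → r ≢ r' →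
                  1 ≤ r → r ≤ N → 1 ≤ r' → r' ≤ N →
                  sumUpTo G N + (F r + F r') ≡ sumUpTo F N + (G r + G r')
sumUpTo-update₂ {F} {G} {r} {r'} N F≗G r≢r' 1≤r r≤N 1≤r' r'≤N = begin
  sumUpTo G N + (F r + F r')   ≡⟨ x∙yz≈xz∙y (sumUpTo G N) (F r) (F r') ⟩
  (sumUpTo G N + F r') + F r   ≡⟨ cong (λ x → (sumUpTo G N + x) + F r) (sym (M-off r' (r≢r' ∘ sym))) ⟩
  (sumUpTo G N + M r') + F r   ≡⟨ cong (_+ F r) (sumUpTo-update N M≗G 1≤r' r'≤N) ⟩
  (sumUpTo M N + G r') + F r   ≡⟨ xy∙z≈xz∙y (sumUpTo M N) (G r') (F r) ⟩
  (sumUpTo M N + F r) + G r'   ≡⟨ cong (_+ G r') (sumUpTo-update N (λ ρ _ _ → sym ∘ M-off ρ) 1≤r r≤N) ⟩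
  (sumUpTo F N + M r) + G r'   ≡⟨ cong (λ x → (sumUpTo F N + x) + G r') M-on ⟩
  (sumUpTo F N + G r) + G r'   ≡⟨ +-assoc (sumUpTo F N) (G r) (G r') ⟩
  sumUpTo F N + (G r + G r')   ∎
  where
  open ≡-Reasoning
  M : ℕ → ℕ
  M ρ = if ρ ≡ᵇ r then G ρ else F ρ
  M-on : M r ≡ G r
  M-on rewrite ≡ᵇ-refl r = refl
  M-off : ∀ ρ → ρ ≢ r → M ρ ≡ F ρ
  M-off ρ ρ≢r rewrite ≡ᵇ-false ρ≢r = refl
  M≗G : ∀ ρ → 1 ≤ ρ → ρ ≤ N → ρ ≢ r' → M ρ ≡ G ρ
  M≗G ρ 1≤ρ ρ≤N ρ≢r' with ρ ≟ r
  ... | yes refl = M-on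
  ... | no ρ≢r   = trans (M-off ρ ρ≢r) (F≗G ρ 1≤ρ ρ≤N ρ≢r ρ≢r')

indicator : Bool → ℕ
indicator true  = 1
indicator false = 0

count : (ℕ → Bool) → ℕ → ℕ
count f = sumUpTo (indicator ∘ f)

length-filter-T? : ∀ (f : ℕ → Bool) xs → length (filter (λ j → T? (f j)) xs) ≡ sum (map (indicator ∘ f) xs)
length-filter-T? f []       = refl
length-filter-T? f (x ∷ xs) with f x
... | true  = cong suc (length-filter-T? f xs)
... | false = length-filter-T? f xs

length-filter-upFrom1 : ∀ (f : ℕ → Bool) L → length (filter (λ j → T? (f j)) (upFrom1 L)) ≡ count f L
length-filter-upFrom1 f L = trans (length-filter-T? f (upFrom1 L)) (sum-map-upFrom1 (indicator ∘ f) L)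

indicator≤1 : ∀ b → indicator b ≤ 1
indicator≤1 true  = ≤-refl
indicator≤1 false = z≤n

count≤ : ∀ f L → count f L ≤ L
count≤ f zero    = z≤n
count≤ f (suc L) = ≤-trans (+-mono-≤ (count≤ f L) (indicator≤1 (f (suc L)))) (≤-reflexive (+-comm L 1))

count<-if-false-from : ∀ {f c} L → 1 ≤ c → (∀ j → c ≤ j → j ≤ L → f j ≡ false) → count f L < c
count<-if-false-from zero    1≤c _ = 1≤c
count<-if-false-from {f} {c} (suc L) 1≤c false-from with c ≤? suc L
... | yes c≤1+L = begin-strict
  count f L + indicator (f (suc L))  ≡⟨ cong (λ b → count f L + indicator b) (false-from (suc L) c≤1+L ≤-refl) ⟩
  count f L + 0                      ≡⟨ +-identityʳ (count f L) ⟩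
  count f L                          <⟨ count<-if-false-from L 1≤c (λ j c≤j j≤L → false-from j c≤j (m≤n⇒m≤1+n j≤L)) ⟩
  c                                  ∎
  where open ≤-Reasoning
... | no c≰1+L = ≤-<-trans (count≤ f (suc L)) (≰⇒> c≰1+L)

count≥-if-true-upto : ∀ {f c} L → c ≤ L → (∀ j → 1 ≤ j → j ≤ c → f j ≡ true) → c ≤ count f L
count≥-if-true-upto zero z≤n _ = z≤n
count≥-if-true-upto {f} {c} (suc L) c≤1+L true-upto with c ≤? L
... | yes c≤L = ≤-trans (count≥-if-true-upto L c≤L true-upto) (m≤m+n (count f L) _)
... | no c≰L with ≤-antisym c≤1+L (≰⇒> c≰L)
... | refl = begin
  suc L                               ≡⟨ +-comm 1 L ⟩
  L + 1                               ≤⟨ +-monoˡ-≤ 1 (count≥-if-true-upto L ≤-refl (λ j 1≤j j≤L → true-upto j 1≤j (m≤n⇒m≤1+n j≤L))) ⟩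
  count f L + 1                       ≡⟨ cong (λ b → count f L + indicator b) (sym (true-upto (suc L) (s≤s z≤n) ≤-refl)) ⟩
  count f L + indicator (f (suc L))   ∎
  where open ≤-Reasoning

count-cong : ∀ {f g} L → (∀ j → 1 ≤ j → j ≤ L → f j ≡ g j) → count f L ≡ count g L
count-cong L f≗g = sumUpTo-cong L (λ j 1≤j j≤L → cong indicator (f≗g j 1≤j j≤L))

count-flip : ∀ {f g c} L → (∀ j → 1 ≤ j → j ≤ L → j ≢ c → f j ≡ g j) → 1 ≤ c → c ≤ L →
             f c ≡ false → g c ≡ true → count g L ≡ suc (count f L)
count-flip {f} {g} {c} L f≗g 1≤c c≤L fc gc = begin
  count g L                    ≡⟨ +-identityʳ (count g L) ⟨
  count g L + 0                ≡⟨ cong (λ b → count g L + indicator b) fc ⟨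
  count g L + indicator (f c)  ≡⟨ sumUpTo-update L (λ j 1≤j j≤L j≢c → cong indicator (f≗g j 1≤j j≤L j≢c)) 1≤c c≤L ⟩
  count f L + indicator (g c)  ≡⟨ cong (λ b → count f L + indicator b) gc ⟩
  count f L + 1                ≡⟨ +-comm (count f L) 1 ⟩
  suc (count f L)              ∎
  where open ≡-Reasoning

⊓-suc : ∀ x k → x ⊓ suc k ≡ x ⊓ k + indicator (suc k ≤ᵇ x)
⊓-suc zero    k       = refl
⊓-suc (suc x) zero    = cong suc (⊓-zeroʳ x)
⊓-suc (suc x) (suc k) = cong suc (⊓-suc x k)

colHeight-∷ : ∀ x γ j → colHeight (x ∷ γ) j ≡ indicator (j ≤ᵇ x) + colHeight γ j
colHeight-∷ x γ j with j ≤ᵇ x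
... | true  = refl
... | false = refl

partialCol-∷ : ∀ x γ k → partialCol (x ∷ γ) k ≡ x ⊓ k + partialCol γ k
partialCol-∷ x γ zero    = sym (trans (+-identityʳ (x ⊓ 0)) (⊓-zeroʳ x))
partialCol-∷ x γ (suc k) = begin
  partialCol (x ∷ γ) k + colHeight (x ∷ γ) (suc k)
    ≡⟨ cong₂ _+_ (partialCol-∷ x γ k) (colHeight-∷ x γ (suc k)) ⟩
  (x ⊓ k + partialCol γ k) + (indicator (suc k ≤ᵇ x) + colHeight γ (suc k))
    ≡⟨ interchange (x ⊓ k) (partialCol γ k) (indicator (suc k ≤ᵇ x)) (colHeight γ (suc k)) ⟩
  (x ⊓ k + indicator (suc k ≤ᵇ x)) + partialCol γ (suc k)
    ≡⟨ cong (_+ partialCol γ (suc k)) (⊓-suc x k) ⟨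
  x ⊓ suc k + partialCol γ (suc k) ∎
  where open ≡-Reasoning

partialCol≡sum-⊓ : ∀ γ k → partialCol γ k ≡ sum (map (_⊓ k) γ)
partialCol≡sum-⊓ []      zero    = refl
partialCol≡sum-⊓ []      (suc k) = trans (+-identityʳ (partialCol [] k)) (partialCol≡sum-⊓ [] k)
partialCol≡sum-⊓ (x ∷ γ) k       = trans (partialCol-∷ x γ k) (cong (x ⊓ k +_) (partialCol≡sum-⊓ γ k))

sum-map-filter-nonzero : ∀ {g} → g 0 ≡ 0 → ∀ xs → sum (map g (filter (λ x → ¬? (x ≟ 0)) xs)) ≡ sum (map g xs)
sum-map-filter-nonzero     g0≡0 []           = refl
sum-map-filter-nonzero {g}     g0≡0 (zero ∷ xs)  = trans (sum-map-filter-nonzero g0≡0 xs) (cong (_+ sum (map g xs)) (sym g0≡0))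
sum-map-filter-nonzero {g}     g0≡0 (suc x ∷ xs) = cong (g (suc x) +_) (sum-map-filter-nonzero g0≡0 xs)

⊓-transfer-≤ : ∀ {a b} k → a < b → a ⊓ k + suc b ⊓ k ≤ suc a ⊓ k + b ⊓ k
⊓-transfer-≤ {a} {b} k a<b with k ≤? a
... | yes k≤a = ≤-reflexive (begin
  a ⊓ k + suc b ⊓ k  ≡⟨ cong₂ _+_ (m≥n⇒m⊓n≡n k≤a) (m≥n⇒m⊓n≡n (m≤n⇒m≤1+n k≤b)) ⟩
  k + k              ≡⟨ cong₂ _+_ (m≥n⇒m⊓n≡n (m≤n⇒m≤1+n k≤a)) (m≥n⇒m⊓n≡n k≤b) ⟨
  suc a ⊓ k + b ⊓ k  ∎)
  where
  open ≡-Reasoning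
  k≤b : k ≤ b
  k≤b = ≤-trans k≤a (<⇒≤ a<b)
... | no k≰a = begin
  a ⊓ k + suc b ⊓ k      ≡⟨ cong (_+ suc b ⊓ k) (m≤n⇒m⊓n≡m (<⇒≤ a<k)) ⟩
  a + suc b ⊓ k          ≤⟨ +-monoʳ-≤ a (⊓-monoʳ-≤ (suc b) (n≤1+n k)) ⟩
  a + suc (b ⊓ k)        ≡⟨ +-suc a (b ⊓ k) ⟩
  suc a + b ⊓ k          ≡⟨ cong (_+ b ⊓ k) (m≤n⇒m⊓n≡m a<k) ⟨
  suc a ⊓ k + b ⊓ k      ∎
  where
  open ≤-Reasoning
  a<k : a < k
  a<k = ≰⇒> k≰a

⊓-transfer-< : ∀ {a b} k → a < k → k ≤ b → a ⊓ k + suc b ⊓ k < suc a ⊓ k + b ⊓ k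
⊓-transfer-< {a} {b} k a<k k≤b = begin-strict
  a ⊓ k + suc b ⊓ k  ≡⟨ cong₂ _+_ (m≤n⇒m⊓n≡m (<⇒≤ a<k)) (m≥n⇒m⊓n≡n (m≤n⇒m≤1+n k≤b)) ⟩
  a + k              <⟨ +-monoˡ-< k (n<1+n a) ⟩
  suc a + k          ≡⟨ cong₂ _+_ (m≤n⇒m⊓n≡m a<k) (m≥n⇒m⊓n≡n k≤b) ⟨
  suc a ⊓ k + b ⊓ k  ∎
  where open ≤-Reasoning

+-balance-≤ : ∀ {x y l r} → x + l ≡ y + r → l ≤ r → y ≤ x
+-balance-≤ {x} {y} {l} {r} x+l≡y+r l≤r =
  +-cancelʳ-≤ l y x (≤-trans (+-monoʳ-≤ y l≤r) (≤-reflexive (sym x+l≡y+r)))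

+-balance-< : ∀ {x y l r} → x + l ≡ y + r → l < r → y < x
+-balance-< {x} {y} {l} {r} x+l≡y+r l<r =
  +-cancelʳ-< l y x (≤-trans (+-monoʳ-< y l<r) (≤-reflexive (sym x+l≡y+r)))

swapVal-i : ∀ i → swapVal i i ≡ suc i
swapVal-i i rewrite ≡ᵇ-refl i = refl

swapVal-1+i : ∀ i → swapVal i (suc i) ≡ i
swapVal-1+i i rewrite ≡ᵇ-false (1+n≢n {i}) | ≡ᵇ-refl i = refl

swapVal-fixes : ∀ {i x} → x ≢ i → x ≢ suc i → swapVal i x ≡ x
swapVal-fixes {i} {x} x≢i x≢1+i rewrite ≡ᵇ-false x≢i | ≡ᵇ-false x≢1+i = refl

swapVal-preserves-<ᵇ : ∀ {m i} x → m ≢ i → (m <ᵇ swapVal i x) ≡ (m <ᵇ x)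
swapVal-preserves-<ᵇ {m} {i} x m≢i with x ≟ i | x ≟ suc i
... | yes refl | _        = trans (cong (m <ᵇ_) (swapVal-i i)) (<ᵇ-suc m≢i)
... | no _     | yes refl = trans (cong (m <ᵇ_) (swapVal-1+i i)) (sym (<ᵇ-suc m≢i))
... | no x≢i   | no x≢1+i = cong (m <ᵇ_) (swapVal-fixes x≢i x≢1+i)

row-bounds : ∀ α ρ → 1 ≤ rowLen α ρ → 1 ≤ ρ × ρ ≤ length α
row-bounds []      _             ()
row-bounds (x ∷ α) zero          ()
row-bounds (x ∷ α) (suc zero)    _    = s≤s z≤n , s≤s z≤n
row-bounds (x ∷ α) (suc (suc ρ)) 1≤αρ = s≤s z≤n , s≤s (proj₂ (row-bounds α (suc ρ) 1≤αρ))

module _ (α β : Composition) where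

  private
    offset : ℕ
    offset = length α ∸ length β

  inOsh-inner : ∀ {ρ j} T m → InInner α β ρ j → inOsh α β T m ρ j ≡ true
  inOsh-inner {ρ} {j} T m (below , _ , inRow)
    with offset <ᵇ ρ | <ᵇ-reflects-< offset ρ | j ≤ᵇ rowLen β (ρ ∸ offset) | ≤ᵇ-reflects-≤ j (rowLen β (ρ ∸ offset))
  ... | true  | _          | true  | _          = refl
  ... | false | ofⁿ ¬below | _     | _          = contradiction below ¬below
  ... | true  | _          | false | ofⁿ ¬inRow = contradiction inRow ¬inRow

  inOsh-skew : ∀ {ρ j} T m → InSkew α β ρ j → inOsh α β T m ρ j ≡ (m <ᵇ T ρ j)
  inOsh-skew {ρ} {j} T m ((_ , 1≤j , _) , ¬inner)
    with offset <ᵇ ρ | <ᵇ-reflects-< offset ρ | j ≤ᵇ rowLen β (ρ ∸ offset) | ≤ᵇ-reflects-≤ j (rowLen β (ρ ∸ offset))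
  ... | false | _         | _     | _         = refl
  ... | true  | _         | false | _         = refl
  ... | true  | ofʸ below | true  | ofʸ inRow = contradiction (below , 1≤j , inRow) ¬inner

  InInner? : ∀ ρ j → Dec (InInner α β ρ j)
  InInner? ρ j = (offset <? ρ) ×-dec ((1 ≤? j) ×-dec (j ≤? rowLen β (ρ ∸ offset)))

  inSkew : ∀ {ρ j} → 1 ≤ j → j ≤ rowLen α ρ → ¬ InInner α β ρ j → InSkew α β ρ j
  inSkew {ρ} 1≤j j≤αρ ¬inner = (proj₁ (row-bounds α ρ (≤-trans 1≤j j≤αρ)) , 1≤j , j≤αρ) , ¬inner

  skew-rightward : ∀ {ρ c j} → InSkew α β ρ c → c ≤ j → j ≤ rowLen α ρ → InSkew α β ρ j
  skew-rightward ((_ , 1≤c , _) , ¬inner) c≤j j≤αρ =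
    inSkew (≤-trans 1≤c c≤j) j≤αρ λ (below , _ , inRow) → ¬inner (below , 1≤c , ≤-trans c≤j inRow)

  inOsh-cong : ∀ {T₁ T₂ m ρ j} → 1 ≤ j → j ≤ rowLen α ρ →
               (InSkew α β ρ j → (m <ᵇ T₂ ρ j) ≡ (m <ᵇ T₁ ρ j)) →
               inOsh α β T₂ m ρ j ≡ inOsh α β T₁ m ρ j
  inOsh-cong {T₁} {T₂} {m} {ρ} {j} 1≤j j≤αρ same with InInner? ρ j
  ... | yes inner = trans (inOsh-inner T₂ m inner) (sym (inOsh-inner T₁ m inner))
  ... | no ¬inner = trans (inOsh-skew T₂ m skew) (trans (same skew) (sym (inOsh-skew T₁ m skew)))
    where
    skew : InSkew α β ρ j
    skew = inSkew 1≤j j≤αρ ¬inner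

  oshRow≡count : ∀ T m ρ → oshRow α β T m ρ ≡ count (inOsh α β T m ρ) (rowLen α ρ)
  oshRow≡count T m ρ = length-filter-upFrom1 (inOsh α β T m ρ) (rowLen α ρ)

  oshRow-cong : ∀ {T₁ T₂ m ρ} → (∀ j → InSkew α β ρ j → (m <ᵇ T₂ ρ j) ≡ (m <ᵇ T₁ ρ j)) →
                oshRow α β T₂ m ρ ≡ oshRow α β T₁ m ρ
  oshRow-cong {T₁} {T₂} {m} {ρ} same = begin
    oshRow α β T₂ m ρ                        ≡⟨ oshRow≡count T₂ m ρ ⟩
    count (inOsh α β T₂ m ρ) (rowLen α ρ)    ≡⟨ count-cong (rowLen α ρ) (λ j 1≤j j≤αρ →
                                                   inOsh-cong {T₁} {T₂} {m} 1≤j j≤αρ (same j)) ⟩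
    count (inOsh α β T₁ m ρ) (rowLen α ρ)    ≡⟨ oshRow≡count T₁ m ρ ⟨
    oshRow α β T₁ m ρ                        ∎
    where open ≡-Reasoning

  osh-cong : ∀ {T₁ T₂ m} → (∀ ρ → oshRow α β T₂ m ρ ≡ oshRow α β T₁ m ρ) → osh α β T₂ m ≡ osh α β T₁ m
  osh-cong rows = cong (filter (λ r → ¬? (r ≟ 0))) (map-cong rows (upFrom1 (length α)))

  sum-map-osh : ∀ {g} → g 0 ≡ 0 → ∀ T m → sum (map g (osh α β T m)) ≡ sumUpTo (g ∘ oshRow α β T m) (length α)
  sum-map-osh {g} g0≡0 T m = begin
    sum (map g (osh α β T m))                            ≡⟨ sum-map-filter-nonzero g0≡0 (map (oshRow α β T m) rows) ⟩
    sum (map g (map (oshRow α β T m) rows))              ≡⟨ cong sum (map-∘ rows) ⟨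
    sum (map (g ∘ oshRow α β T m) rows)                  ≡⟨ sum-map-upFrom1 (g ∘ oshRow α β T m) (length α) ⟩
    sumUpTo (g ∘ oshRow α β T m) (length α)              ∎
    where
    open ≡-Reasoning
    rows : List ℕ
    rows = upFrom1 (length α)

  sum-osh : ∀ T m → sum (osh α β T m) ≡ sumUpTo (oshRow α β T m) (length α)
  sum-osh T m = trans (cong sum (sym (map-id (osh α β T m)))) (sum-map-osh refl T m)

  partialCol-osh : ∀ T m k → partialCol (osh α β T m) k ≡ sumUpTo ((_⊓ k) ∘ oshRow α β T m) (length α)
  partialCol-osh T m k = trans (partialCol≡sum-⊓ (osh α β T m) k) (sum-map-osh refl T m)

  oshRow-flip : ∀ {T₁ T₂ m ρ c} → InSkew α β ρ c → T₁ ρ c ≤ m → m < T₂ ρ c →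
                (∀ j → InSkew α β ρ j → j ≢ c → (m <ᵇ T₂ ρ j) ≡ (m <ᵇ T₁ ρ j)) →
                oshRow α β T₂ m ρ ≡ suc (oshRow α β T₁ m ρ)
  oshRow-flip {T₁} {T₂} {m} {ρ} {c} s T₁ρc≤m m<T₂ρc same = begin
    oshRow α β T₂ m ρ                              ≡⟨ oshRow≡count T₂ m ρ ⟩
    count (inOsh α β T₂ m ρ) (rowLen α ρ)          ≡⟨ count-flip (rowLen α ρ) agree 1≤c c≤αρ
                                                        (trans (inOsh-skew T₁ m s) (<ᵇ-false T₁ρc≤m))
                                                        (trans (inOsh-skew T₂ m s) (<ᵇ-true m<T₂ρc)) ⟩
    suc (count (inOsh α β T₁ m ρ) (rowLen α ρ))    ≡⟨ cong suc (oshRow≡count T₁ m ρ) ⟨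
    suc (oshRow α β T₁ m ρ)                        ∎
    where
    open ≡-Reasoning
    1≤c : 1 ≤ c
    1≤c = proj₁ (proj₂ (proj₁ s))
    c≤αρ : c ≤ rowLen α ρ
    c≤αρ = proj₂ (proj₂ (proj₁ s))
    agree : ∀ j → 1 ≤ j → j ≤ rowLen α ρ → j ≢ c → inOsh α β T₁ m ρ j ≡ inOsh α β T₂ m ρ j
    agree j 1≤j j≤αρ j≢c = sym (inOsh-cong {T₁} {T₂} {m} 1≤j j≤αρ (λ sk → same j sk j≢c))

  module _ {n T} (S : IsSCT α β n T) where
    open IsSCT S using (rowDecr)

    row-antitone : ∀ {ρ c j} → InSkew α β ρ c → c ≤ j → j ≤ rowLen α ρ → T ρ j ≤ T ρ c
    row-antitone {ρ} {c} s c≤j = go (≤⇒≤′ c≤j)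
      where
      go : ∀ {j} → c ≤′ j → j ≤ rowLen α ρ → T ρ j ≤ T ρ c
      go ≤′-refl                 _        = ≤-refl
      go {suc j} (≤′-step c≤′j) 1+j≤αρ =
        ≤-trans (<⇒≤ (rowDecr ρ j (skew-rightward s (≤′⇒≤ c≤′j) (<⇒≤ 1+j≤αρ))
                                  (skew-rightward s (≤′⇒≤ (≤′-step c≤′j)) 1+j≤αρ)))
                (go c≤′j (<⇒≤ 1+j≤αρ))

    oshRow<-if-entry≤ : ∀ {m ρ c} → InSkew α β ρ c → T ρ c ≤ m → oshRow α β T m ρ < c
    oshRow<-if-entry≤ {m} {ρ} {c} s Tρc≤m =
      subst (_< c) (sym (oshRow≡count T m ρ)) (count<-if-false-from (rowLen α ρ) (proj₁ (proj₂ (proj₁ s))) outside)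
      where
      outside : ∀ j → c ≤ j → j ≤ rowLen α ρ → inOsh α β T m ρ j ≡ false
      outside j c≤j j≤αρ =
        trans (inOsh-skew T m (skew-rightward s c≤j j≤αρ)) (<ᵇ-false (≤-trans (row-antitone s c≤j j≤αρ) Tρc≤m))

    oshRow≥-if-entry> : ∀ {m ρ c} → InSkew α β ρ c → m < T ρ c → c ≤ oshRow α β T m ρ
    oshRow≥-if-entry> {m} {ρ} {c} s m<Tρc =
      subst (c ≤_) (sym (oshRow≡count T m ρ)) (count≥-if-true-upto (rowLen α ρ) c≤αρ inside)
      where
      c≤αρ : c ≤ rowLen α ρ
      c≤αρ = proj₂ (proj₂ (proj₁ s))
      inside : ∀ j → 1 ≤ j → j ≤ c → inOsh α β T m ρ j ≡ true
      inside j 1≤j j≤c with InInner? ρ j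
      ... | yes inner = inOsh-inner T m inner
      ... | no ¬inner = trans (inOsh-skew T m sk) (<ᵇ-true (<-≤-trans m<Tρc (row-antitone sk j≤c c≤αρ)))
        where
        sk : InSkew α β ρ j
        sk = inSkew 1≤j (≤-trans j≤c c≤αρ) ¬inner

osh-πnAD-off-i : ∀ α β T₁ T₂ {i} m → (∀ r c → InSkew α β r c → T₂ r c ≡ πnAD i T₁ r c) → m ≢ i →
                 osh α β T₂ m ≡ osh α β T₁ m
osh-πnAD-off-i α β T₁ T₂ m T₂≡πT₁ m≢i =
  osh-cong α β {T₁} {T₂} {m} λ ρ → oshRow-cong α β {T₁} {T₂} {m} λ j s →
    trans (cong (m <ᵇ_) (T₂≡πT₁ ρ j s)) (swapVal-preserves-<ᵇ (T₁ ρ j) m≢i)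

module NonAttackingSwap
  {α β : Composition} {n i : ℕ} {T₁ T₂ : Filling} (S : IsSCT α β n T₁)
  (T₂≡πT₁ : ∀ r c → InSkew α β r c → T₂ r c ≡ πnAD i T₁ r c)
  {r c r' c' : ℕ} (s : InSkew α β r c) (s' : InSkew α β r' c')
  (T₁rc≡i : T₁ r c ≡ i) (T₁r'c'≡1+i : T₁ r' c' ≡ suc i)
  (c≤c' : c ≤ c') (¬attacks : ¬ Attacks (r , c) (r' , c'))
  where

  open IsSCT S using (injective)

  row₁ row₂ : ℕ → ℕ
  row₁ = oshRow α β T₁ i
  row₂ = oshRow α β T₂ i

  N : ℕ
  N = length α

  c<c' : c < c'
  c<c' = ≤∧≢⇒< c≤c' c≢c'
    where
    c≢c' : c ≢ c'
    c≢c' c≡c' with r ≟ r'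
    ... | yes refl = 1+n≢n (trans (sym T₁r'c'≡1+i) (trans (cong (T₁ r) (sym c≡c')) T₁rc≡i))
    ... | no r≢r'  = ¬attacks (inj₁ (c≡c' , r≢r'))

  r≢r' : r ≢ r'
  r≢r' refl = <⇒≱ (n<1+n i)
    (subst₂ _≤_ T₁r'c'≡1+i T₁rc≡i (row-antitone α β S s (<⇒≤ c<c') (proj₂ (proj₂ (proj₁ s')))))

  T₂rc≡1+i : T₂ r c ≡ suc i
  T₂rc≡1+i = trans (T₂≡πT₁ r c s) (trans (cong (swapVal i) T₁rc≡i) (swapVal-i i))

  T₂r'c'≡i : T₂ r' c' ≡ i
  T₂r'c'≡i = trans (T₂≡πT₁ r' c' s') (trans (cong (swapVal i) T₁r'c'≡1+i) (swapVal-1+i i))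

  unmoved : ∀ {ρ j} → InSkew α β ρ j → ¬ (ρ ≡ r × j ≡ c) → ¬ (ρ ≡ r' × j ≡ c') → (i <ᵇ T₂ ρ j) ≡ (i <ᵇ T₁ ρ j)
  unmoved {ρ} {j} sk ≢rc ≢r'c' = cong (i <ᵇ_) (trans (T₂≡πT₁ ρ j sk) (swapVal-fixes ≢i ≢1+i))
    where
    ≢i : T₁ ρ j ≢ i
    ≢i eq = ≢rc (injective ρ j r c sk s (trans eq (sym T₁rc≡i)))
    ≢1+i : T₁ ρ j ≢ suc i
    ≢1+i eq = ≢r'c' (injective ρ j r' c' sk s' (trans eq (sym T₁r'c'≡1+i)))

  rows-agree : ∀ ρ → ρ ≢ r → ρ ≢ r' → row₁ ρ ≡ row₂ ρ
  rows-agree ρ ρ≢r ρ≢r' = sym (oshRow-cong α β {T₁} {T₂} {i} (λ j sk → unmoved sk (ρ≢r ∘ proj₁) (ρ≢r' ∘ proj₁)))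

  row-r-gains : row₂ r ≡ suc (row₁ r)
  row-r-gains = oshRow-flip α β {T₁} {T₂} {i} s (≤-reflexive T₁rc≡i) (≤-reflexive (sym T₂rc≡1+i))
                  (λ j sk j≢c → unmoved sk (j≢c ∘ proj₂) (r≢r' ∘ proj₁))

  row-r'-loses : row₁ r' ≡ suc (row₂ r')
  row-r'-loses = oshRow-flip α β {T₂} {T₁} {i} s' (≤-reflexive T₂r'c'≡i) (≤-reflexive (sym T₁r'c'≡1+i))
                   (λ j sk j≢c' → sym (unmoved sk (r≢r' ∘ sym ∘ proj₁) (j≢c' ∘ proj₂)))

  a b : ℕ
  a = row₁ r
  b = row₂ r'

  a<b : a < b
  a<b = <-≤-trans (oshRow<-if-entry≤ α β S s (≤-reflexive T₁rc≡i)) (m<1+n⇒m≤n (<-≤-trans c<c' c'≤1+b))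
    where
    c'≤1+b : c' ≤ suc b
    c'≤1+b = subst (c' ≤_) row-r'-loses (oshRow≥-if-entry> α β S s' (≤-reflexive (sym T₁r'c'≡1+i)))

  transfer : ∀ g → sumUpTo (g ∘ row₂) N + (g a + g (suc b)) ≡ sumUpTo (g ∘ row₁) N + (g (suc a) + g b)
  transfer g = begin
    sumUpTo (g ∘ row₂) N + (g a + g (suc b))          ≡⟨ cong (λ x → sumUpTo (g ∘ row₂) N + (g a + g x)) row-r'-loses ⟨
    sumUpTo (g ∘ row₂) N + (g (row₁ r) + g (row₁ r'))  ≡⟨ sumUpTo-update₂ N (λ ρ _ _ ρ≢r ρ≢r' → cong g (rows-agree ρ ρ≢r ρ≢r'))
                                                           r≢r' (proj₁ r∈) (proj₂ r∈) (proj₁ r'∈) (proj₂ r'∈) ⟩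
    sumUpTo (g ∘ row₁) N + (g (row₂ r) + g (row₂ r'))  ≡⟨ cong (λ x → sumUpTo (g ∘ row₁) N + (g x + g b)) row-r-gains ⟩
    sumUpTo (g ∘ row₁) N + (g (suc a) + g b)          ∎
    where
    open ≡-Reasoning
    r∈ : 1 ≤ r × r ≤ N
    r∈ = row-bounds α r (≤-trans (proj₁ (proj₂ (proj₁ s))) (proj₂ (proj₂ (proj₁ s))))
    r'∈ : 1 ≤ r' × r' ≤ N
    r'∈ = row-bounds α r' (≤-trans (proj₁ (proj₂ (proj₁ s'))) (proj₂ (proj₂ (proj₁ s'))))

  sum-preserved : sum (osh α β T₂ i) ≡ sum (osh α β T₁ i)
  sum-preserved = begin
    sum (osh α β T₂ i)  ≡⟨ sum-osh α β T₂ i ⟩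
    sumUpTo row₂ N      ≡⟨ +-cancelʳ-≡ (a + suc b) _ _ (trans (transfer id) (cong (sumUpTo row₁ N +_) (sym (+-suc a b)))) ⟩
    sumUpTo row₁ N      ≡⟨ sum-osh α β T₁ i ⟨
    sum (osh α β T₁ i)  ∎
    where open ≡-Reasoning

  partialCol-≤ : ∀ k → partialCol (osh α β T₁ i) k ≤ partialCol (osh α β T₂ i) k
  partialCol-≤ k = subst₂ _≤_ (sym (partialCol-osh α β T₁ i k)) (sym (partialCol-osh α β T₂ i k))
                     (+-balance-≤ (transfer (_⊓ k)) (⊓-transfer-≤ k a<b))

  partialCol-< : partialCol (osh α β T₁ i) (suc a) < partialCol (osh α β T₂ i) (suc a)
  partialCol-< = subst₂ _<_ (sym (partialCol-osh α β T₁ i (suc a))) (sym (partialCol-osh α β T₂ i (suc a)))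
                   (+-balance-< (transfer (_⊓ suc a)) (⊓-transfer-< (suc a) ≤-refl a<b))

  osh-descends : osh α β T₂ i ⊴ osh α β T₁ i × osh α β T₂ i ≢ osh α β T₁ i
  osh-descends = (sum-preserved , λ k _ → partialCol-≤ k) ,
                 λ eq → <⇒≢ partialCol-< (cong (λ γ → partialCol γ (suc a)) (sym eq))

lemma3p6 : (α β : Composition) (n : ℕ) (T₁ T₂ : Filling) (i : ℕ) →
           SCT α β n T₁ → SCT α β n T₂ →
           InNAD α β n T₁ i →
           (∀ r c → InSkew α β r c → T₂ r c ≡ πnAD i T₁ r c) →
           (osh α β T₂ i ⊴ osh α β T₁ i × osh α β T₂ i ≢ osh α β T₁ i)
           × (∀ m → m ≤ n → m ≢ i → osh α β T₂ m ≡ osh α β T₁ m)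
lemma3p6 α β n T₁ T₂ i S₁ _ (_ , _ , r , c , r' , c' , s , s' , T₁rc≡i , T₁r'c'≡1+i , c≤c' , ¬attacks) T₂≡πT₁ =
  NonAttackingSwap.osh-descends (SCT.isSCT S₁) T₂≡πT₁ s s' T₁rc≡i T₁r'c'≡1+i c≤c' ¬attacks ,
  λ m _ m≢i → osh-πnAD-off-i α β T₁ T₂ m T₂≡πT₁ m≢i
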